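{- The formulas $\mathrm{POR}$ and $|\gimel_2|\le 4$ are universally equivalent, i.e. the formula $\mathrm{POR}\leftrightarrow(|\gimel_2|\le 4)$ is realized by a proof-like term with respect to every pole.
   Context: $\lambda_c$-calculus. Fix a countably infinite set of variables. $\lambda_c$-terms are given by $t,u ::= x \mid tu \mid \lambda x.t \mid \mathrm{cc} \mid k_\pi$ ($\pi$ a stack) $\mid \kappa_m$ ($m\in\mathbb{N}$, non-restricted instructions) $\mid \beta_m$ ($m\in\mathbb{N}$, restricted instructions), modulo $\alpha$-equivalence. A term is a closed $\lambda_c$-term; $\Lambda$ is the set of terms. Stacks: $\pi ::= \omega_m$ ($m\in\mathbb{N}$) $\mid t\cdot\pi$ ($t\in\Lambda$); $\Pi$ is the set of stacks. Processes are pairs $t\star\pi$. One-step evaluation $\succ_1$ is the smallest relation on processes with $tu\star\pi \succ_1 t\star u\cdot\pi$, $\lambda x.t\star u\cdot\pi\succ_1 t[x:=u]\star\pi$, $\mathrm{cc}\star t\cdot\pi\succ_1 t\star k_\pi\cdot\pi$, $k_{\pi'}\star t\cdot\pi\succ_1 t\star\pi'$; $\succ$ is its reflexive-transitive closure. A pole is a set $\perp\!\!\!\perp$ of processes such that $p\succ q$ and $q\in\perp\!\!\!\perp$ imply $p\in\perp\!\!\!\perp$. A term is proof-like if it contains no $k_\pi$ and no restricted instruction. Formulas. First-order terms: $a ::= x \mid f(a_1,\dots,a_k)$ for any $f:\mathbb{N}^k\to\mathbb{N}$. Formulas: $A,B ::= X(a_1,\dots,a_k)$ ($X$ a $k$-ary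 second-order variable, $k\ge0$) $\mid \top\mid\bot\mid A\to B\mid \forall x\,A\mid\forall X\,A\mid (a=b)\hookrightarrow A\mid A\cap B\mid A\cup B\mid F(a_1,\dots,a_k)$ ($F:\mathbb{N}^k\to\mathcal{P}(\Pi)$). For a pole $\perp\!\!\!\perp$ and closed $A$: $\|\top\|=\emptyset$, $\|\bot\|=\Pi$, $\|A\to B\|=\{t\cdot\pi: t\in|A|,\pi\in\|B\|\}$, $\|\forall x A\|=\bigcup_{m}\|A[x:=m]\|$, $\|\forall X A\|=\bigcup_{F:\mathbb{N}^k\to\mathcal{P}(\Pi)}\|A[X:=F]\|$, $\|(a=b)\hookrightarrow A\|=\|A\|$ if $a,b$ have equal values else $\emptyset$, $\|A\cap B\|=\|A\|\cup\|B\|$, $\|A\cup B\|=\|A\|\cap\|B\|$, $\|F(\vec a)\|=F(\text{values})$; $|A|=\{t:\forall\pi\in\|A\|,\ t\star\pi\in\perp\!\!\!\perp\}$; $t$ realizes $A$ w.r.t. $\perp\!\!\!\perp$ if $t\in|A|$. Abbreviations: $a=b$ is $\forall Z(Z(a)\to Z(b))$; $a\neq b$ is $(a=b)\hookrightarrow\bot$; $A\wedge B$ is $\forall Z((A\to B\to Z)\to Z)$, $A\vee B$ is $\forall Z((A\to Z)\to(B\to Z)\to Z)$, $A\leftrightarrow B$ is $(A\to B)\wedge(B\to A)$. Two closed formulas $A,B$ are universally equivalent if $A\leftrightarrow B$ is realized by some proof-like term w.r.t. every pole. $\mathrm{Bool}(y)$ denotes $\forall X\,(X(0)\to X(1)\to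 X(y))$ ($X$ unary). $\mathrm{POR}$ denotes $(\mathrm{Bool}(1)\to\top\to\mathrm{Bool}(1))\cap(\top\to\mathrm{Bool}(1)\to\mathrm{Bool}(1))\cap(\mathrm{Bool}(0)\to\mathrm{Bool}(0)\to\mathrm{Bool}(0))$. $\gimel_2$. On $\mathbb{N}$: $m\vee n=1$ if $m>0$ or $n>0$, else $0$; $m\wedge n=1$ if both $>0$, else $0$; $\neg m=1$ if $m=0$, else $0$. $\gimel_2(a)$ is the formula $\min(a+1,2)=a+1$. For a formula $A$ built from variables, $0,1,\vee,\wedge,\neg$ (on terms) and $\top,\bot,=,\neq,\to,\vee,\wedge,\forall x$, $\gimel_2\models A$ is $A$ with every $\forall x\,B$ replaced by $\forall x(\gimel_2(x)\hookrightarrow B)$. $|\gimel_2|\le 4$ denotes $\gimel_2\models\forall x_1\dots x_5\ \bigvee_{i\neq j}(x_i=x_j)$. -}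

module Defs where

import Level
open import Level using (Lift; lift)
open import Data.Nat using (ℕ; zero; suc; _+_; _⊓_)
open import Data.Fin using (Fin; zero; suc)
open import Data.Vec using (Vec; []; _∷_)
open import Data.Product using (Σ; _×_; _,_)
open import Data.Sum using (_⊎_)
open import Data.Empty using (⊥)
open import Data.Unit using (⊤)
open import Relation.Binary.PropositionalEquality using (_≡_)
open import Relation.Binary.Construct.Closure.ReflexiveTransitive using (Star)

-- λc-terms (scoped de Bruijn syntax: Tm n = terms with at most n free
-- variables; α-equivalence is built in) and stacks.

mutual
  data Tm (n : ℕ) : Set where
    var : Fin n → Tm n
    app : Tm n → Tm n → Tm n
    lam : Tm (suc n) → Tm n
    cc  : Tm n
    k   : Stack → Tm n
    κ   : ℕ → Tm n
    β   : ℕ → Tm n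

  data Stack : Set where
    ω   : ℕ → Stack
    _·_ : Tm 0 → Stack → Stack

infixr 5 _·_

Λ : Set
Λ = Tm 0

ext : ∀ {n m} → (Fin n → Fin m) → Fin (suc n) → Fin (suc m)
ext ρ zero    = zero
ext ρ (suc i) = suc (ρ i)

ren : ∀ {n m} → (Fin n → Fin m) → Tm n → Tm m
ren ρ (var i)   = var (ρ i)
ren ρ (app t u) = app (ren ρ t) (ren ρ u)
ren ρ (lam t)   = lam (ren (ext ρ) t)
ren ρ cc        = cc
ren ρ (k π)     = k π
ren ρ (κ m)     = κ m
ren ρ (β m)     = β m

exts : ∀ {n m} → (Fin n → Tm m) → Fin (suc n) → Tm (suc m)
exts σ zero    = var zero
exts σ (suc i) = ren suc (σ i)

sub : ∀ {n m} → (Fin n → Tm m) → Tm n → Tm m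
sub σ (var i)   = σ i
sub σ (app t u) = app (sub σ t) (sub σ u)
sub σ (lam t)   = lam (sub (exts σ) t)
sub σ cc        = cc
sub σ (k π)     = k π
sub σ (κ m)     = κ m
sub σ (β m)     = β m

_[_] : Tm 1 → Tm 0 → Tm 0
t [ u ] = sub (λ _ → u) t

data Process : Set where
  _⋆_ : Λ → Stack → Process

infix 4 _⋆_

data _≻₁_ : Process → Process → Set where
  push    : ∀ {t u π}    → (app t u ⋆ π) ≻₁ (t ⋆ u · π)
  grab    : ∀ {t u π}    → (lam t ⋆ u · π) ≻₁ ((t [ u ]) ⋆ π)
  save    : ∀ {t π}      → (cc ⋆ t · π) ≻₁ (t ⋆ k π · π)
  restore : ∀ {π' t π}   → (k π' ⋆ t · π) ≻₁ (t ⋆ π')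

_≻_ : Process → Process → Set
_≻_ = Star _≻₁_

record Pole : Set₁ where
  field
    ⊥⊥     : Process → Set
    closed : ∀ {p q} → p ≻ q → ⊥⊥ q → ⊥⊥ p

data ProofLike {n : ℕ} : Tm n → Set where
  var : ∀ i → ProofLike (var i)
  app : ∀ {t u} → ProofLike t → ProofLike u → ProofLike (app t u)
  lam : ∀ {t} → ProofLike {suc n} t → ProofLike (lam t)
  cc  : ProofLike cc
  κ   : ∀ m → ProofLike (κ m)

-- Closed formulas (higher-order abstract syntax: first-order terms are
-- represented by their values in ℕ, bound variables by Agda functions;
-- a bound k-ary second-order variable ranges over F : ℕ^k → P(Π)).

Pred : ℕ → Set₁
Pred n = Vec ℕ n → Stack → Set

data Formula : Set₁ where
  ⊤'   : Formula
  ⊥'   : Formula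
  _⇒_  : Formula → Formula → Formula
  ∀¹   : (ℕ → Formula) → Formula
  ∀²   : (n : ℕ) → (Pred n → Formula) → Formula
  _≐_↪_ : ℕ → ℕ → Formula → Formula
  _∩_  : Formula → Formula → Formula
  _∪_  : Formula → Formula → Formula
  pred : ∀ {n} → Pred n → Vec ℕ n → Formula

infixr 6 _⇒_
infixr 7 _∩_ _∪_

module Interp (P : Pole) where
  open Pole P

  mutual
    ‖_‖ : Formula → Stack → Set₁
    ‖ ⊤' ‖ π = Lift (Level.suc Level.zero) ⊥
    ‖ ⊥' ‖ π = Lift (Level.suc Level.zero) ⊤
    ‖ A ⇒ B ‖ π = Σ Λ λ t → Σ Stack λ π' → Lift (Level.suc Level.zero) (π ≡ t · π') × ∣ A ∣ t × ‖ B ‖ π'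
    ‖ ∀¹ Φ ‖ π = Σ ℕ λ m → ‖ Φ m ‖ π
    ‖ ∀² n Φ ‖ π = Σ (Pred n) λ F → ‖ Φ F ‖ π
    ‖ a ≐ b ↪ A ‖ π = Lift (Level.suc Level.zero) (a ≡ b) × ‖ A ‖ π
    ‖ A ∩ B ‖ π = ‖ A ‖ π ⊎ ‖ B ‖ π
    ‖ A ∪ B ‖ π = ‖ A ‖ π × ‖ B ‖ π
    ‖ pred F as ‖ π = Lift (Level.suc Level.zero) (F as π)

    ∣_∣ : Formula → Λ → Set₁
    ∣ A ∣ t = ∀ π → ‖ A ‖ π → Lift (Level.suc Level.zero) (⊥⊥ (t ⋆ π))

  _⊩_ : Λ → Formula → Set₁
  t ⊩ A = ∣ A ∣ t

_≑_ : ℕ → ℕ → Formula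
a ≑ b = ∀² 1 λ Z → pred Z (a ∷ []) ⇒ pred Z (b ∷ [])

_≠'_ : ℕ → ℕ → Formula
a ≠' b = a ≐ b ↪ ⊥'

_∧'_ : Formula → Formula → Formula
A ∧' B = ∀² 0 λ Z → (A ⇒ B ⇒ pred Z []) ⇒ pred Z []

_∨'_ : Formula → Formula → Formula
A ∨' B = ∀² 0 λ Z → (A ⇒ pred Z []) ⇒ (B ⇒ pred Z []) ⇒ pred Z []

infixr 4 _∧'_ _∨'_

_⇔_ : Formula → Formula → Formula
A ⇔ B = (A ⇒ B) ∧' (B ⇒ A)

Bool : ℕ → Formula
Bool y = ∀² 1 λ X → pred X (0 ∷ []) ⇒ pred X (1 ∷ []) ⇒ pred X (y ∷ [])

POR : Formula
POR = (Bool 1 ⇒ ⊤' ⇒ Bool 1)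
    ∩ (⊤' ⇒ Bool 1 ⇒ Bool 1)
    ∩ (Bool 0 ⇒ Bool 0 ⇒ Bool 0)

∀ℷ₂ : (ℕ → Formula) → Formula
∀ℷ₂ Φ = ∀¹ λ x → ((x + 1) ⊓ 2) ≐ (x + 1) ↪ Φ x

Card≤4 : Formula
Card≤4 = ∀ℷ₂ λ x₁ → ∀ℷ₂ λ x₂ → ∀ℷ₂ λ x₃ → ∀ℷ₂ λ x₄ → ∀ℷ₂ λ x₅ →
    (x₁ ≑ x₂) ∨' (x₁ ≑ x₃) ∨' (x₁ ≑ x₄) ∨' (x₁ ≑ x₅)
  ∨' (x₂ ≑ x₃) ∨' (x₂ ≑ x₄) ∨' (x₂ ≑ x₅)
  ∨' (x₃ ≑ x₄) ∨' (x₃ ≑ x₅)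
  ∨' (x₄ ≑ x₅)

UniversallyEquivalent : Formula → Formula → Set₁
UniversallyEquivalent A B =
  Σ Λ λ θ → ProofLike θ × ((P : Pole) → Interp._⊩_ P θ (A ⇔ B))

module Submission where

-- Since ℷ₂(x) says x ∈ {0,1}, a realizer of |ℷ₂| ≤ 4 must, for five unknown
-- bits, jump into the handler of one of the ten disjuncts xᵢ = xⱼ that holds;
-- it sees only the stack, not the bits.
--
-- (POR → |ℷ₂| ≤ 4)  The realizer 'gather' walks through the ten nested
--   disjunctions, saving with cc a jump kσ(f I) for each handler f; such a jump
--   is valid whenever its equality holds.  The ten jumps are handed to the
--   'decider', a closed term compiled from a small language of programs and
--   partial booleans whose parallel or is the given realizer of POR.  A finite
--   check over all 32 bit vectors shows the decider always reaches a valid jump.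
-- (|ℷ₂| ≤ 4 → POR)  Given c realizing |ℷ₂| ≤ 4 and the arguments a, b of POR,
--   we feed c handlers answering like a, like b, or with 1; in each of the three
--   clauses of POR the bits are chosen so that only correct handlers can fire.

open import Defs
open import Level using (lift; lower)
open import Data.Nat using (ℕ; zero; suc; _+_; _⊓_; _≡ᵇ_)
open import Data.Nat.Properties using (⊓-zeroʳ; m+1+n≢0; ≡ᵇ⇒≡; suc-injective)
open import Data.Bool using (true; false; T; _∧_; _∨_; not) renaming (Bool to 𝔹)
open import Data.Bool.Properties using (T-∧; T-∨)
open import Data.Fin using (Fin; zero; suc; #_)
open import Data.Vec using (Vec; []; _∷_) renaming (lookup to lookupᵛ)
open import Data.List using (List; []; _∷_; length; lookup)
open import Data.List.Relation.Binary.Pointwise using (Pointwise; []; _∷_)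
open import Data.Product using (_×_; _,_; proj₁; proj₂)
open import Data.Sum using (inj₁; inj₂)
open import Data.Empty using (⊥-elim)
open import Data.Unit using (⊤; tt)
open import Function using (_∘_)
open import Function.Bundles using (Equivalence)
open import Relation.Binary.PropositionalEquality using (_≡_; refl; sym; trans; cong; cong₂; subst; subst₂)
open import Relation.Binary.Construct.Closure.ReflexiveTransitive using (ε; _◅_)

private
  variable
    n m l : ℕ

ext-cong : {ρ ρ' : Fin n → Fin m} → (∀ i → ρ i ≡ ρ' i) → ∀ i → ext ρ i ≡ ext ρ' i
ext-cong h zero    = refl
ext-cong h (suc i) = cong suc (h i)

ren-cong : {ρ ρ' : Fin n → Fin m} → (∀ i → ρ i ≡ ρ' i) → ∀ t → ren ρ t ≡ ren ρ' t
ren-cong h (var i)   = cong var (h i)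
ren-cong h (app t u) = cong₂ app (ren-cong h t) (ren-cong h u)
ren-cong h (lam t)   = cong lam (ren-cong (ext-cong h) t)
ren-cong h cc        = refl
ren-cong h (k π)     = refl
ren-cong h (κ i)     = refl
ren-cong h (β i)     = refl

exts-cong : {σ σ' : Fin n → Tm m} → (∀ i → σ i ≡ σ' i) → ∀ i → exts σ i ≡ exts σ' i
exts-cong h zero    = refl
exts-cong h (suc i) = cong (ren suc) (h i)

sub-cong : {σ σ' : Fin n → Tm m} → (∀ i → σ i ≡ σ' i) → ∀ t → sub σ t ≡ sub σ' t
sub-cong h (var i)   = h i
sub-cong h (app t u) = cong₂ app (sub-cong h t) (sub-cong h u)
sub-cong h (lam t)   = cong lam (sub-cong (exts-cong h) t)
sub-cong h cc        = refl
sub-cong h (k π)     = refl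
sub-cong h (κ i)     = refl
sub-cong h (β i)     = refl

ren-ren : (ρ : Fin m → Fin l) (ρ' : Fin n → Fin m) → ∀ t → ren ρ (ren ρ' t) ≡ ren (ρ ∘ ρ') t
ren-ren ρ ρ' (var i)   = refl
ren-ren ρ ρ' (app t u) = cong₂ app (ren-ren ρ ρ' t) (ren-ren ρ ρ' u)
ren-ren ρ ρ' (lam t)   =
  cong lam (trans (ren-ren (ext ρ) (ext ρ') t) (ren-cong (λ { zero → refl ; (suc i) → refl }) t))
ren-ren ρ ρ' cc        = refl
ren-ren ρ ρ' (k π)     = refl
ren-ren ρ ρ' (κ i)     = refl
ren-ren ρ ρ' (β i)     = refl

sub-ren : (σ : Fin m → Tm l) (ρ : Fin n → Fin m) → ∀ t → sub σ (ren ρ t) ≡ sub (σ ∘ ρ) t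
sub-ren σ ρ (var i)   = refl
sub-ren σ ρ (app t u) = cong₂ app (sub-ren σ ρ t) (sub-ren σ ρ u)
sub-ren σ ρ (lam t)   =
  cong lam (trans (sub-ren (exts σ) (ext ρ) t) (sub-cong (λ { zero → refl ; (suc i) → refl }) t))
sub-ren σ ρ cc        = refl
sub-ren σ ρ (k π)     = refl
sub-ren σ ρ (κ i)     = refl
sub-ren σ ρ (β i)     = refl

ren-sub : (ρ : Fin m → Fin l) (σ : Fin n → Tm m) → ∀ t → ren ρ (sub σ t) ≡ sub (ren ρ ∘ σ) t
ren-sub ρ σ (var i)   = refl
ren-sub ρ σ (app t u) = cong₂ app (ren-sub ρ σ t) (ren-sub ρ σ u)
ren-sub ρ σ (lam t)   = cong lam (trans (ren-sub (ext ρ) (exts σ) t) (sub-cong commute t))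
  where
    commute : ∀ i → ren (ext ρ) (exts σ i) ≡ exts (ren ρ ∘ σ) i
    commute zero    = refl
    commute (suc i) = trans (ren-ren (ext ρ) suc (σ i)) (sym (ren-ren suc ρ (σ i)))
ren-sub ρ σ cc        = refl
ren-sub ρ σ (k π)     = refl
ren-sub ρ σ (κ i)     = refl
ren-sub ρ σ (β i)     = refl

sub-sub : (τ : Fin m → Tm l) (σ : Fin n → Tm m) → ∀ t → sub τ (sub σ t) ≡ sub (sub τ ∘ σ) t
sub-sub τ σ (var i)   = refl
sub-sub τ σ (app t u) = cong₂ app (sub-sub τ σ t) (sub-sub τ σ u)
sub-sub τ σ (lam t)   = cong lam (trans (sub-sub (exts τ) (exts σ) t) (sub-cong commute t))
  where
    commute : ∀ i → sub (exts τ) (exts σ i) ≡ exts (sub τ ∘ σ) i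
    commute zero    = refl
    commute (suc i) = trans (sub-ren (exts τ) suc (σ i)) (sym (ren-sub suc τ (σ i)))
sub-sub τ σ cc        = refl
sub-sub τ σ (k π)     = refl
sub-sub τ σ (κ i)     = refl
sub-sub τ σ (β i)     = refl

sub-var : ∀ (t : Tm n) → sub var t ≡ t
sub-var (var i)   = refl
sub-var (app t u) = cong₂ app (sub-var t) (sub-var u)
sub-var (lam t)   = cong lam (trans (sub-cong (λ { zero → refl ; (suc i) → refl }) t) (sub-var t))
sub-var cc        = refl
sub-var (k π)     = refl
sub-var (κ i)     = refl
sub-var (β i)     = refl

sub-closed : (σ : Fin 0 → Λ) (t : Λ) → sub σ t ≡ t
sub-closed σ t = trans (sub-cong (λ ()) t) (sub-var t)

_∷ₛ_ : Λ → (Fin n → Λ) → Fin (suc n) → Λ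
(u ∷ₛ ρ) zero    = u
(u ∷ₛ ρ) (suc i) = ρ i

infixr 5 _∷ₛ_

sub-exts-[] : (ρ : Fin n → Λ) (t : Tm (suc n)) (u : Λ) → (sub (exts ρ) t) [ u ] ≡ sub (u ∷ₛ ρ) t
sub-exts-[] ρ t u = trans (sub-sub (λ _ → u) (exts ρ) t) (sub-cong instantiate t)
  where
    instantiate : ∀ i → sub (λ _ → u) (exts ρ i) ≡ (u ∷ₛ ρ) i
    instantiate zero    = refl
    instantiate (suc i) = trans (sub-ren (λ _ → u) suc (ρ i)) (sub-closed _ (ρ i))

↑ : Λ → Tm n
↑ = ren (λ ())

sub-↑ : (ρ : Fin n → Λ) (t : Λ) → sub ρ (↑ t) ≡ t
sub-↑ ρ t = trans (sub-ren ρ (λ ()) t) (sub-closed _ t)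

-- j ⊕ n is j + n, computed by moving binders one at a time into the context,
-- so that the outermost of j abstractions can be peeled off.
_⊕_ : ℕ → ℕ → ℕ
zero  ⊕ n = n
suc j ⊕ n = j ⊕ suc n

lams : ∀ j → Tm (j ⊕ n) → Tm n
lams zero    t = t
lams (suc j) t = lam (lams j t)

extend : ∀ {j} → (Fin n → Λ) → Vec Λ j → Fin (j ⊕ n) → Λ
extend ρ []       = ρ
extend ρ (J ∷ Js) = extend (J ∷ₛ ρ) Js

shift : ∀ j → Fin n → Fin (j ⊕ n)
shift zero    i = i
shift (suc j) i = shift j (suc i)

slot : ∀ {j} → Fin j → Fin (j ⊕ n)
slot {j = suc j} zero    = shift j zero
slot {j = suc j} (suc i) = slot i

extend-shift : ∀ {j} (ρ : Fin n → Λ) (Js : Vec Λ j) i → extend ρ Js (shift j i) ≡ ρ i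
extend-shift ρ []       i = refl
extend-shift ρ (J ∷ Js) i = extend-shift (J ∷ₛ ρ) Js (suc i)

extend-slot : ∀ {j} (ρ : Fin n → Λ) (Js : Vec Λ j) i → extend ρ Js (slot i) ≡ lookupᵛ Js i
extend-slot ρ (J ∷ Js) zero    = extend-shift (J ∷ₛ ρ) Js zero
extend-slot ρ (J ∷ Js) (suc i) = extend-slot (J ∷ₛ ρ) Js i

I 𝟙 : Tm n
I = lam (var zero)
𝟙 = lam (lam (var zero))

⌊_⌋ : 𝔹 → ℕ
⌊ false ⌋ = 0
⌊ true ⌋  = 1

choose : 𝔹 → Λ → Λ → Λ
choose false v₀ v₁ = v₀
choose true  v₀ v₁ = v₁

pair : Λ → Λ → Λ
pair t u = lam (app (app (var zero) (↑ t)) (↑ u))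

Eq : ℕ × ℕ → Formula
Eq (a , b) = a ≑ b

Disj : ℕ × ℕ → List (ℕ × ℕ) → Formula
Disj e []        = Eq e
Disj e (e' ∷ es) = Eq e ∨' Disj e' es

Disjunction : List (ℕ × ℕ) → Formula
Disjunction []       = ⊥'
Disjunction (e ∷ es) = Disj e es

module Machine (P : Pole) where
  open Pole P public
  open Interp P public

  back : ∀ {p q} → p ≻₁ q → ⊥⊥ q → ⊥⊥ p
  back s = closed (s ◅ ε)

  Valid : Λ → Set
  Valid t = ∀ π → ⊥⊥ (t ⋆ π)

  lam-step : (ρ : Fin n → Λ) (t : Tm (suc n)) (u : Λ) (π : Stack) →
             ⊥⊥ (sub (u ∷ₛ ρ) t ⋆ π) → ⊥⊥ (sub ρ (lam t) ⋆ u · π)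
  lam-step ρ t u π h = back grab (subst (λ s → ⊥⊥ (s ⋆ π)) (sym (sub-exts-[] ρ t u)) h)

  lam-step₂ : (ρ : Fin n → Λ) (t : Tm (suc (suc n))) (u v : Λ) (π : Stack) →
              ⊥⊥ (sub (v ∷ₛ u ∷ₛ ρ) t ⋆ π) → ⊥⊥ (sub ρ (lam (lam t)) ⋆ u · v · π)
  lam-step₂ ρ t u v π h = lam-step ρ (lam t) u (v · π) (lam-step (u ∷ₛ ρ) t v π h)

  ⊤-realizer : ∀ t → t ⊩ ⊤'
  ⊤-realizer t π (lift ())

  I-realizes : ∀ {a b} → a ≡ b → I ⊩ (a ≑ b)
  I-realizes refl .(t · π) (Z , t , π , lift refl , t⊩ , lift z) =
    lift (back grab (lower (t⊩ π (lift z))))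

  pair-realizes : ∀ {A B t u} → t ⊩ A → u ⊩ B → pair t u ⊩ (A ∧' B)
  pair-realizes {t = t} {u} t⊩ u⊩ .(h · π) (Z , h , π , lift refl , h⊩ , lift z) =
    lift (back grab (back push (back push
      (subst₂ (λ t' u' → ⊥⊥ (h ⋆ t' · u' · π)) (sym (sub-↑ _ t)) (sym (sub-↑ _ u))
        (lower (h⊩ _ (t , _ , lift refl , t⊩ , (u , π , lift refl , u⊩ , lift z))))))))

  Good : 𝔹 → Λ → Set
  Good o t = ∀ v₀ v₁ π → ⊥⊥ (choose o v₀ v₁ ⋆ π) → ⊥⊥ (t ⋆ v₀ · v₁ · π)

  good⇒Bool : ∀ {o t} → Good o t → t ⊩ Bool ⌊ o ⌋
  good⇒Bool {false} g .(v₀ · v₁ · π) (X , v₀ , _ , lift refl , v₀⊩ , (v₁ , π , lift refl , _ , lift x)) =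
    lift (g v₀ v₁ π (lower (v₀⊩ π (lift x))))
  good⇒Bool {true} g .(v₀ · v₁ · π) (X , v₀ , _ , lift refl , _ , (v₁ , π , lift refl , v₁⊩ , lift x)) =
    lift (g v₀ v₁ π (lower (v₁⊩ π (lift x))))

  𝟙-realizes : 𝟙 ⊩ Bool 1
  𝟙-realizes = good⇒Bool {true} λ v₀ v₁ π h → back grab (back grab h)

  bool-stack : ∀ o {v₀ v₁ π} → ⊥⊥ (choose o v₀ v₁ ⋆ π) → ‖ Bool ⌊ o ⌋ ‖ (v₀ · v₁ · π)
  bool-stack false {v₀} {v₁} {π} h =
    X , v₀ , _ , lift refl , (λ { _ (lift (refl , refl)) → lift h }) ,
    (v₁ , π , lift refl , (λ { _ (lift (() , _)) }) , lift (refl , refl))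
    where
      X : Pred 1
      X (y ∷ []) s = (y ≡ 0) × (s ≡ π)
  bool-stack true {v₀} {v₁} {π} h =
    X , v₀ , _ , lift refl , (λ { _ (lift (() , _)) }) ,
    (v₁ , π , lift refl , (λ { _ (lift (refl , refl)) → lift h }) , lift (refl , refl))
    where
      X : Pred 1
      X (y ∷ []) s = (y ≡ 1) × (s ≡ π)

  module _ {p : Λ} (p⊩ : p ⊩ POR) where
    por-left : ∀ {a c} → Good true a → Good true (app (app p a) c)
    por-left {a} {c} ga v₀ v₁ π h = back push (back push (lower (p⊩ _ (inj₁
      (a , _ , lift refl , good⇒Bool ga , (c , _ , lift refl , ⊤-realizer c , bool-stack true h))))))

    por-right : ∀ {a c} → Good true c → Good true (app (app p a) c)
    por-right {a} {c} gc v₀ v₁ π h = back push (back push (lower (p⊩ _ (inj₂ (inj₁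
      (a , _ , lift refl , ⊤-realizer a , (c , _ , lift refl , good⇒Bool gc , bool-stack true h)))))))

    por-both : ∀ {a c} → Good false a → Good false c → Good false (app (app p a) c)
    por-both {a} {c} ga gc v₀ v₁ π h = back push (back push (lower (p⊩ _ (inj₂ (inj₂
      (a , _ , lift refl , good⇒Bool ga , (c , _ , lift refl , good⇒Bool gc , bool-stack false h)))))))

  JumpFor : ℕ × ℕ → Λ → Set
  JumpFor (a , b) J = a ≡ b → Valid J

  data Jumps : List (ℕ × ℕ) → Stack → Set where
    []  : ∀ {π} → Jumps [] π
    _∷_ : ∀ {e es J π} → JumpFor e J → Jumps es π → Jumps (e ∷ es) (J · π)

  Runs : Λ → List (ℕ × ℕ) → Set
  Runs t es = ∀ π → Jumps es π → ⊥⊥ (t ⋆ π)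

  runs-app : ∀ {c e es J} → Runs c (e ∷ es) → JumpFor e J → Runs (app c J) es
  runs-app r j π js = back push (r _ (j ∷ js))

  runs-lam : ∀ {e es} (ρ : Fin n → Λ) (t : Tm (suc n)) →
             (∀ J → JumpFor e J → Runs (sub (J ∷ₛ ρ) t) es) → Runs (sub ρ (lam t)) (e ∷ es)
  runs-lam ρ t h .(_ · π) (_∷_ {J = J} {π = π} j js) = lam-step ρ t J π (h J j π js)

  JumpsFor : (es : List (ℕ × ℕ)) → Vec Λ (length es) → Set
  JumpsFor []       []       = ⊤
  JumpsFor (e ∷ es) (J ∷ Js) = JumpFor e J × JumpsFor es Js

  jumps-lookup : ∀ es Js → JumpsFor es Js → ∀ i → JumpFor (lookup es i) (lookupᵛ Js i)
  jumps-lookup (e ∷ es) (J ∷ Js) (j , js) zero    = j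
  jumps-lookup (e ∷ es) (J ∷ Js) (j , js) (suc i) = jumps-lookup es Js js i

  runs-lams : (ρ : Fin n → Λ) (es : List (ℕ × ℕ)) (t : Tm (length es ⊕ n)) →
              (∀ Js → JumpsFor es Js → Valid (sub (extend ρ Js) t)) →
              Runs (sub ρ (lams (length es) t)) es
  runs-lams ρ []       t h π [] = h [] tt π
  runs-lams ρ (e ∷ es) t h      =
    runs-lam ρ (lams (length es) t) λ J j → runs-lams (J ∷ₛ ρ) es t λ Js js → h (J ∷ Js) (j , js)

  -- Returning I to the handler f of a disjunct through the continuation σ
  -- saved when f was received: valid as soon as the disjunct holds.
  jump-valid : ∀ {e f σ} {Z : Pred 0} → f ⊩ (Eq e ⇒ pred Z []) → Z [] σ →
               JumpFor e (app (k σ) (app f I))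
  jump-valid {σ = σ} f⊩ z e-holds π =
    back push (back restore (back push (lower (f⊩ _ (I , σ , lift refl , I-realizes e-holds , lift z)))))

-- λc.λf.λg. cc (λk. body): receive an accumulator c, the two handlers f, g of a
-- disjunction, and save the current continuation.
catch : Tm 4 → Λ
catch body = lam (lam (lam (app cc (lam body))))

jumpTo : Fin 4 → Tm 4
jumpTo h = app (var zero) (app (var h) I)

-- gather m handles a disjunction of m + 2 equalities: the jump for the first
-- disjunct is passed to the accumulator c, and the rest of the disjunction is
-- handed to the second handler g: for gather (suc m) it is gather m with the
-- accumulator c J.
gather : ℕ → Λ
gather zero    = catch (app (app (var (# 3)) (jumpTo (# 2))) (jumpTo (# 1)))
gather (suc m) = catch (app (var (# 1)) (app (↑ (gather m)) (app (var (# 3)) (jumpTo (# 2)))))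

module Gather (P : Pole) where
  open Machine P

  catch-step : ∀ body c f g σ → ⊥⊥ (sub (k σ ∷ₛ g ∷ₛ f ∷ₛ (λ _ → c)) body ⋆ σ) →
               ⊥⊥ (catch body ⋆ c · f · g · σ)
  catch-step body c f g σ h =
    back grab (lam-step₂ (λ _ → c) (app cc (lam body)) f g σ
      (back push (back save (lam-step (g ∷ₛ f ∷ₛ (λ _ → c)) body (k σ) σ h))))

  gather-sound : ∀ c {e e' es} → Runs c (e ∷ e' ∷ es) →
                 ∀ π → ‖ Disjunction (e ∷ e' ∷ es) ‖ π → ⊥⊥ (gather (length es) ⋆ c · π)
  gather-sound c {es = []} r .(f · g · σ)
    (Z , f , _ , lift refl , f⊩ , (g , σ , lift refl , g⊩ , lift z)) =
    catch-step _ c f g σ (back push (back push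
      (r _ (jump-valid {Z = Z} f⊩ z ∷ (jump-valid {Z = Z} g⊩ z ∷ [])))))
  gather-sound c {e' = e'} {e'' ∷ es} r .(f · g · σ)
    (Z , f , _ , lift refl , f⊩ , (g , σ , lift refl , g⊩ , lift z)) =
    catch-step _ c f g σ (back push (lower (g⊩ _ (_ , σ , lift refl , rest⊩ , lift z))))
    where
      J : Λ
      J = app (k σ) (app f I)
      rest⊩ : app (sub (k σ ∷ₛ g ∷ₛ f ∷ₛ (λ _ → c)) (↑ (gather (length es)))) (app c J) ⊩
              Disjunction (e' ∷ e'' ∷ es)
      rest⊩ π s = lift (back push (subst (λ G → ⊥⊥ (G ⋆ app c J · π)) (sym (sub-↑ _ _))
        (gather-sound (app c J) (runs-app r (jump-valid {Z = Z} f⊩ z)) π s)))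

-- Programs over m jumps, and tests: partial booleans that a program branches on.
-- A program viewed as a test never returns, so it may stand for either outcome.
mutual
  data Prog (m : ℕ) : Set where
    jump          : Fin m → Prog m
    if_then_else_ : Test m → Prog m → Prog m → Prog m

  data Test (m : ℕ) : Set where
    ⟨_⟩ : Prog m → Test m
    neg : Test m → Test m
    por : Test m → Test m → Test m

-- Three-valued semantics, given which jumps are valid: 'succeeds C' says C
-- surely reaches a valid jump, 'yields o b' that b surely behaves as o or jumps.
module Semantics {m} (holds : Fin m → 𝔹) where
  mutual
    succeeds : Prog m → 𝔹
    succeeds (jump i)             = holds i
    succeeds (if b then C else D) = (yields true b ∧ succeeds C) ∨ (yields false b ∧ succeeds D)

    yields : 𝔹 → Test m → 𝔹
    yields o     ⟨ C ⟩     = succeeds C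
    yields o     (neg b)   = yields (not o) b
    yields true  (por a c) = yields true a ∨ yields true c
    yields false (por a c) = yields false a ∧ yields false c

record Layout (m n : ℕ) : Set where
  field
    jumpAt : Fin m → Fin n
    porAt  : Fin n
open Layout

under : Layout m n → Layout m (suc (suc n))
under L = record { jumpAt = λ i → suc (suc (jumpAt L i)) ; porAt = suc (suc (porAt L)) }

-- 'if b then C else D' is b D C; a test is λv₀.λv₁. body with
--   ⟨ C ⟩ ↦ C,   neg b ↦ b v₁ v₀,   por a c ↦ p a c v₀ v₁.
mutual
  compile : Layout m n → Prog m → Tm n
  compile L (jump i)             = var (jumpAt L i)
  compile L (if b then C else D) = app (app (compileTest L b) (compile L D)) (compile L C)

  compileTest : Layout m n → Test m → Tm n
  compileTest L b = lam (lam (testBody (under L) b))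

  testBody : Layout m (suc (suc n)) → Test m → Tm (suc (suc n))
  testBody L ⟨ C ⟩     = compile L C
  testBody L (neg b)   = app (app (compileTest L b) (var zero)) (var (suc zero))
  testBody L (por a c) =
    app (app (app (app (var (porAt L)) (compileTest L a)) (compileTest L c)) (var (suc zero))) (var zero)

module Soundness (P : Pole) {m} (holds : Fin m → 𝔹) where
  open Machine P
  open Semantics holds
  open Equivalence

  record Ready (ρ : Fin n → Λ) (L : Layout m n) : Set₁ where
    field
      porReady  : ρ (porAt L) ⊩ POR
      jumpReady : ∀ i → T (holds i) → Valid (ρ (jumpAt L i))
  open Ready

  ready-under : ∀ {ρ : Fin n → Λ} {L v₀ v₁} → Ready ρ L → Ready (v₁ ∷ₛ v₀ ∷ₛ ρ) (under L)
  ready-under r = record { porReady = porReady r ; jumpReady = jumpReady r }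

  mutual
    run-sound : ∀ {ρ : Fin n → Λ} {L} → Ready ρ L → ∀ C → T (succeeds C) →
                Valid (sub ρ (compile L C))
    run-sound r (jump i) h = jumpReady r i h
    run-sound r (if b then C else D) h π with to T-∨ h
    ... | inj₁ h₁ = back push (back push
          (test-sound r true b (proj₁ (to T-∧ h₁)) _ _ π (run-sound r C (proj₂ (to T-∧ h₁)) π)))
    ... | inj₂ h₀ = back push (back push
          (test-sound r false b (proj₁ (to T-∧ h₀)) _ _ π (run-sound r D (proj₂ (to T-∧ h₀)) π)))

    test-sound : ∀ {ρ : Fin n → Λ} {L} → Ready ρ L → ∀ o b → T (yields o b) →
                 Good o (sub ρ (compileTest L b))
    test-sound {ρ = ρ} {L} r o b h v₀ v₁ π ok =
      lam-step₂ ρ (testBody (under L) b) v₀ v₁ π (body-sound (ready-under r) o b h π ok)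

    body-sound : ∀ {ρ : Fin n → Λ} {L v₀ v₁} → Ready (v₁ ∷ₛ v₀ ∷ₛ ρ) L → ∀ o b → T (yields o b) →
                 ∀ π → ⊥⊥ (choose o v₀ v₁ ⋆ π) → ⊥⊥ (sub (v₁ ∷ₛ v₀ ∷ₛ ρ) (testBody L b) ⋆ π)
    body-sound r o ⟨ C ⟩ h π _ = run-sound r C h π
    body-sound r false (neg b) h π ok = back push (back push (test-sound r true b h _ _ π ok))
    body-sound r true  (neg b) h π ok = back push (back push (test-sound r false b h _ _ π ok))
    body-sound r true (por a c) h π ok with to T-∨ h
    ... | inj₁ ha = back push (back push (por-left (porReady r) (test-sound r true a ha) _ _ π ok))
    ... | inj₂ hc = back push (back push (por-right (porReady r) (test-sound r true c hc) _ _ π ok))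
    body-sound r false (por a c) h π ok = back push (back push
      (por-both (porReady r) (test-sound r false a (proj₁ (to T-∧ h)))
                             (test-sound r false c (proj₂ (to T-∧ h))) _ _ π ok))

pairs : ℕ → ℕ → ℕ → ℕ → ℕ → List (ℕ × ℕ)
pairs x₁ x₂ x₃ x₄ x₅ =
  (x₁ , x₂) ∷ (x₁ , x₃) ∷ (x₁ , x₄) ∷ (x₁ , x₅) ∷ (x₂ , x₃) ∷
  (x₂ , x₄) ∷ (x₂ , x₅) ∷ (x₃ , x₄) ∷ (x₃ , x₅) ∷ (x₄ , x₅) ∷ []

holdsPair : ℕ × ℕ → 𝔹
holdsPair (a , b) = a ≡ᵇ b

equalPairs : ℕ → ℕ → ℕ → ℕ → ℕ → Fin 10 → 𝔹
equalPairs x₁ x₂ x₃ x₄ x₅ i = holdsPair (lookup (pairs x₁ x₂ x₃ x₄ x₅) i)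

try : Fin m → Test m
try i = ⟨ jump i ⟩

and : Test m → Test m → Test m
and a c = neg (por (neg a) (neg c))

-- A program reaching a valid jump for every five bits (found by computer search).
decide : Prog 10
decide =
  if por (and (por (try (# 0)) (por (try (# 1)) (try (# 4))))
              ⟨ if por (try (# 0)) (por (try (# 2)) (try (# 5)))
                then (if por (try (# 1)) (try (# 6)) then jump (# 8) else jump (# 1))
                else jump (# 0) ⟩)
         ⟨ shared ⟩
  then (if por (neg (por (try (# 0)) (try (# 9)))) (neg (por (try (# 3)) (try (# 5))))
        then (if por (try (# 0)) (por (try (# 1)) (try (# 4)))
              then (if por (try (# 3)) (try (# 7)) then jump (# 8) else jump (# 3))
              else jump (# 0))
        else (if por (try (# 0)) (por (try (# 2)) (try (# 5)))
              then (if por (try (# 3)) (try (# 6)) then jump (# 9) else jump (# 0))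
              else jump (# 0)))
  else shared
  where
    shared : Prog 10
    shared =
      if por (neg (por (try (# 0)) (try (# 7)))) (neg (por (try (# 2)) (try (# 4))))
      then (if por (try (# 0)) (por (try (# 3)) (try (# 6)))
            then (if por (try (# 2)) (try (# 8)) then jump (# 9) else jump (# 2))
            else jump (# 0))
      else (if por (try (# 0)) (por (try (# 1)) (try (# 4)))
            then (if por (try (# 2)) (try (# 5)) then jump (# 7) else jump (# 0))
            else jump (# 0))

data Bit : ℕ → Set where
  bit₀ : Bit 0
  bit₁ : Bit 1

ℷ₂⇒Bit : ∀ x → (x + 1) ⊓ 2 ≡ x + 1 → Bit x
ℷ₂⇒Bit zero          _ = bit₀
ℷ₂⇒Bit (suc zero)    _ = bit₁
ℷ₂⇒Bit (suc (suc x)) h =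
  ⊥-elim (m+1+n≢0 x (trans (sym (suc-injective (suc-injective h))) (⊓-zeroʳ (x + 1))))

Bit⇒ℷ₂ : ∀ {x} → Bit x → (x + 1) ⊓ 2 ≡ x + 1
Bit⇒ℷ₂ bit₀ = refl
Bit⇒ℷ₂ bit₁ = refl

-- A property of bits, checked on both bits.  It is kept opaque so that
-- onBits f determines f when used as a hypothesis.
opaque
  onBits : (ℕ → 𝔹) → 𝔹
  onBits f = f 0 ∧ f 1

  onBits-sound : ∀ {f x} → T (onBits f) → Bit x → T (f x)
  onBits-sound h bit₀ = proj₁ (Equivalence.to T-∧ h)
  onBits-sound h bit₁ = proj₂ (Equivalence.to T-∧ h)

onBits⁵ : (ℕ → ℕ → ℕ → ℕ → ℕ → 𝔹) → 𝔹
onBits⁵ F = onBits λ x₁ → onBits λ x₂ → onBits λ x₃ → onBits λ x₄ → onBits (F x₁ x₂ x₃ x₄)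

onBits⁵-sound : ∀ F {x₁ x₂ x₃ x₄ x₅} → T (onBits⁵ F) →
                Bit x₁ → Bit x₂ → Bit x₃ → Bit x₄ → Bit x₅ → T (F x₁ x₂ x₃ x₄ x₅)
onBits⁵-sound F h b₁ b₂ b₃ b₄ b₅ =
  onBits-sound (onBits-sound (onBits-sound (onBits-sound (onBits-sound h b₁) b₂) b₃) b₄) b₅

decideSucceeds : ℕ → ℕ → ℕ → ℕ → ℕ → 𝔹
decideSucceeds x₁ x₂ x₃ x₄ x₅ = Semantics.succeeds (equalPairs x₁ x₂ x₃ x₄ x₅) decide

opaque
  unfolding onBits

  decide-checked : T (onBits⁵ decideSucceeds)
  decide-checked = tt

decide-succeeds : ∀ {x₁ x₂ x₃ x₄ x₅} → Bit x₁ → Bit x₂ → Bit x₃ → Bit x₄ → Bit x₅ →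
                  T (decideSucceeds x₁ x₂ x₃ x₄ x₅)
decide-succeeds = onBits⁵-sound decideSucceeds decide-checked

deciderLayout : Layout 10 11
deciderLayout = record { jumpAt = slot ; porAt = shift 10 zero }

decider : Λ
decider = lam (lams 10 (compile deciderLayout decide))

module Decider (P : Pole) where
  open Machine P

  fire : ∀ e {J} → T (holdsPair e) → JumpFor e J → Valid J
  fire (a , b) h j = j (≡ᵇ⇒≡ a b h)

  decider-runs : ∀ {p x₁ x₂ x₃ x₄ x₅} → p ⊩ POR → Bit x₁ → Bit x₂ → Bit x₃ → Bit x₄ → Bit x₅ →
                 Runs (app decider p) (pairs x₁ x₂ x₃ x₄ x₅)
  decider-runs {p} {x₁} {x₂} {x₃} {x₄} {x₅} p⊩ b₁ b₂ b₃ b₄ b₅ π js =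
    back push (back grab (runs-lams ρ₀ es (compile deciderLayout decide) run π js))
    where
      open Soundness P (equalPairs x₁ x₂ x₃ x₄ x₅)
      es = pairs x₁ x₂ x₃ x₄ x₅
      ρ₀ : Fin 1 → Λ
      ρ₀ _ = p
      ready : ∀ Js → JumpsFor es Js → Ready (extend ρ₀ Js) deciderLayout
      ready Js jumps = record
        { porReady  = subst (_⊩ POR) (sym (extend-shift ρ₀ Js zero)) p⊩
        ; jumpReady = λ i h → subst Valid (sym (extend-slot ρ₀ Js i))
                                     (fire (lookup es i) h (jumps-lookup es Js jumps i))
        }
      run : ∀ Js → JumpsFor es Js → Valid (sub (extend ρ₀ Js) (compile deciderLayout decide))
      run Js jumps = run-sound (ready Js jumps) decide (decide-succeeds b₁ b₂ b₃ b₄ b₅)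

toCard≤4 : Λ
toCard≤4 = lam (app (↑ (gather 8)) (app (↑ decider) (var zero)))

module ToCard≤4 (P : Pole) where
  open Machine P
  open Gather P
  open Decider P

  toCard≤4-realizes : toCard≤4 ⊩ (POR ⇒ Card≤4)
  toCard≤4-realizes .(p · π) (p , π , lift refl , p⊩ ,
    (x₁ , lift g₁ , x₂ , lift g₂ , x₃ , lift g₃ , x₄ , lift g₄ , x₅ , lift g₅ , s)) =
    lift (back grab (back push
      (subst₂ (λ G D → ⊥⊥ (G ⋆ app D p · π))
              (sym (sub-↑ {n = 1} (λ _ → p) (gather 8))) (sym (sub-↑ {n = 1} (λ _ → p) decider))
        (gather-sound (app decider p)
          (decider-runs p⊩ (ℷ₂⇒Bit x₁ g₁) (ℷ₂⇒Bit x₂ g₂) (ℷ₂⇒Bit x₃ g₃) (ℷ₂⇒Bit x₄ g₄) (ℷ₂⇒Bit x₅ g₅))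
          π s))))

eqHandler : Tm n → Tm n
eqHandler L = lam (app (var zero) (ren suc L))

handler : Tm n → List (Tm n) → Tm n
handler L []        = eqHandler L
handler L (L' ∷ Ls) = lam (app (app (var zero) (ren suc (eqHandler L))) (ren suc (handler L' Ls)))

-- In the context c, a, b: answer like a, like b, or with 1.
ask-a ask-b ask-1 : Tm 3
ask-a = var (# 1)
ask-b = var (# 0)
ask-1 = 𝟙

otherAnswers : List (Tm 3)
otherAnswers = ask-a ∷ ask-a ∷ ask-a ∷ ask-a ∷ ask-a ∷ ask-a ∷ ask-b ∷ ask-b ∷ ask-1 ∷ []

fromCard≤4 : Λ
fromCard≤4 = lam (lam (lam (app (handler ask-b otherAnswers) (var (# 2)))))

module FromCard≤4 (P : Pole) where
  open Machine P

  At : Stack → Pred 0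
  At σ _ s = s ≡ σ

  Answers : (ρ : Fin n → Λ) → Stack → ℕ × ℕ → Tm n → Set
  Answers ρ σ (a , b) L = a ≡ b → ⊥⊥ (sub ρ L ⋆ σ)

  -- instantiating the equality a = b with "y = b at σ"
  eqHandler-realizes : ∀ (ρ : Fin n → Λ) σ e L → Answers ρ σ e L →
                       sub ρ (eqHandler L) ⊩ (Eq e ⇒ pred (At σ) [])
  eqHandler-realizes ρ σ (a , b) L answer .(t · σ) (t , σ , lift refl , t⊩ , lift refl) =
    lift (lam-step ρ (app (var zero) (ren suc L)) t σ (back push
      (subst (λ u → ⊥⊥ (t ⋆ u · σ)) (sym (sub-ren (t ∷ₛ ρ) suc L))
        (lower (t⊩ _ (Z , sub ρ L , σ , lift refl , L⊩ , lift (refl , refl)))))))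
    where
      Z : Pred 1
      Z (y ∷ []) s = (y ≡ b) × (s ≡ σ)
      L⊩ : sub ρ L ⊩ pred Z (a ∷ [])
      L⊩ _ (lift (a≡b , refl)) = lift (answer a≡b)

  -- instantiating each disjunction with At σ
  handler-realizes : ∀ (ρ : Fin n → Λ) σ {e es L Ls} → Pointwise (Answers ρ σ) (e ∷ es) (L ∷ Ls) →
                     sub ρ (handler L Ls) ⊩ (Disjunction (e ∷ es) ⇒ pred (At σ) [])
  handler-realizes ρ σ {e} {[]} {L} {[]} (answer ∷ []) = eqHandler-realizes ρ σ e L answer
  handler-realizes ρ σ {e} {e' ∷ es} {L} {L' ∷ Ls} (answer ∷ rest) .(d · σ)
    (d , σ , lift refl , d⊩ , lift refl) =
    lift (lam-step ρ (app (app (var zero) (ren suc H₁)) (ren suc H₂)) d σ (back push (back push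
      (subst₂ (λ u v → ⊥⊥ (d ⋆ u · v · σ)) (sym (sub-ren (d ∷ₛ ρ) suc H₁)) (sym (sub-ren (d ∷ₛ ρ) suc H₂))
        (lower (d⊩ _ (At σ , _ , _ , lift refl , eqHandler-realizes ρ σ e L answer ,
                      (_ , σ , lift refl , handler-realizes ρ σ rest , lift refl))))))))
    where
      H₁ H₂ : Tm _
      H₁ = eqHandler L
      H₂ = handler L' Ls

  Card≤4-at : ∀ {c x₁ x₂ x₃ x₄ x₅} → c ⊩ Card≤4 → Bit x₁ → Bit x₂ → Bit x₃ → Bit x₄ → Bit x₅ →
              c ⊩ Disjunction (pairs x₁ x₂ x₃ x₄ x₅)
  Card≤4-at {x₁ = x₁} {x₂} {x₃} {x₄} {x₅} c⊩ b₁ b₂ b₃ b₄ b₅ σ s =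
    c⊩ σ (x₁ , lift (Bit⇒ℷ₂ b₁) , x₂ , lift (Bit⇒ℷ₂ b₂) , x₃ , lift (Bit⇒ℷ₂ b₃) ,
          x₄ , lift (Bit⇒ℷ₂ b₄) , x₅ , lift (Bit⇒ℷ₂ b₅) , s)

  fromCard≤4-step : ∀ {c a b σ x₁ x₂ x₃ x₄ x₅} → c ⊩ Card≤4 →
    Bit x₁ → Bit x₂ → Bit x₃ → Bit x₄ → Bit x₅ →
    Pointwise (Answers (b ∷ₛ a ∷ₛ (λ _ → c)) σ) (pairs x₁ x₂ x₃ x₄ x₅)
      (ask-b ∷ otherAnswers) →
    ⊥⊥ (fromCard≤4 ⋆ c · a · b · σ)
  fromCard≤4-step {c} {a} {b} {σ} c⊩ b₁ b₂ b₃ b₄ b₅ answers =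
    back grab (lam-step₂ (λ _ → c) (app (handler ask-b otherAnswers) (var (# 2))) a b σ (back push
      (lower (handler-realizes (b ∷ₛ a ∷ₛ (λ _ → c)) σ answers _
                (c , σ , lift refl , Card≤4-at c⊩ b₁ b₂ b₃ b₄ b₅ , lift refl)))))

  -- an answer that needs no hypothesis: t realizes Bool y and σ is a stack of it
  answered : ∀ {t σ y} → t ⊩ Bool y → ‖ Bool y ‖ σ → ∀ {x : ℕ} → x ≡ x → ⊥⊥ (t ⋆ σ)
  answered t⊩ s _ = lower (t⊩ _ s)

  -- In each clause of POR, choose the bits so that exactly the pairs answered
  -- by a realizer of the expected boolean are equal.
  fromCard≤4-realizes : fromCard≤4 ⊩ (Card≤4 ⇒ POR)
  fromCard≤4-realizes .(c · a · b · σ)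
    (c , _ , lift refl , c⊩ , inj₁ (a , _ , lift refl , a⊩ , (b , σ , lift refl , _ , s))) =
    lift (fromCard≤4-step c⊩ bit₀ bit₁ bit₀ bit₁ bit₁
      ((λ ()) ∷ answered a⊩ s ∷ (λ ()) ∷ (λ ()) ∷ (λ ()) ∷
       answered a⊩ s ∷ answered a⊩ s ∷ (λ ()) ∷ (λ ()) ∷ answered 𝟙-realizes s ∷ []))
  fromCard≤4-realizes .(c · a · b · σ)
    (c , _ , lift refl , c⊩ , inj₂ (inj₁ (a , _ , lift refl , _ , (b , σ , lift refl , b⊩ , s)))) =
    lift (fromCard≤4-step c⊩ bit₀ bit₀ bit₁ bit₁ bit₁
      (answered b⊩ s ∷ (λ ()) ∷ (λ ()) ∷ (λ ()) ∷ (λ ()) ∷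
       (λ ()) ∷ (λ ()) ∷ answered b⊩ s ∷ answered b⊩ s ∷ answered 𝟙-realizes s ∷ []))
  fromCard≤4-realizes .(c · a · b · σ)
    (c , _ , lift refl , c⊩ , inj₂ (inj₂ (a , _ , lift refl , a⊩ , (b , σ , lift refl , b⊩ , s)))) =
    lift (fromCard≤4-step c⊩ bit₀ bit₁ bit₀ bit₀ bit₁
      ((λ ()) ∷ answered a⊩ s ∷ answered a⊩ s ∷ (λ ()) ∷ (λ ()) ∷
       (λ ()) ∷ answered a⊩ s ∷ answered b⊩ s ∷ (λ ()) ∷ (λ ()) ∷ []))

isProofLike : Tm n → 𝔹
isProofLike (var i)   = true
isProofLike (app t u) = isProofLike t ∧ isProofLike u
isProofLike (lam t)   = isProofLike t
isProofLike cc        = true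
isProofLike (k π)     = false
isProofLike (κ i)     = true
isProofLike (β i)     = false

isProofLike-sound : ∀ (t : Tm n) → T (isProofLike t) → ProofLike t
isProofLike-sound (var i)   _ = var i
isProofLike-sound (app t u) h with Equivalence.to T-∧ h
... | ht , hu = app (isProofLike-sound t ht) (isProofLike-sound u hu)
isProofLike-sound (lam t)   h = lam (isProofLike-sound t h)
isProofLike-sound cc        _ = cc
isProofLike-sound (κ i)     _ = κ i

θ : Λ
θ = pair toCard≤4 fromCard≤4

θ-proofLike : ProofLike θ
θ-proofLike = isProofLike-sound θ tt

θ-realizes : (P : Pole) → Interp._⊩_ P θ (POR ⇔ Card≤4)
θ-realizes P = pair-realizes {A = POR ⇒ Card≤4} {B = Card≤4 ⇒ POR}
  (ToCard≤4.toCard≤4-realizes P) (FromCard≤4.fromCard≤4-realizes P)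
  where open Machine P

mainTheorem2 : UniversallyEquivalent POR Card≤4
mainTheorem2 = θ , θ-proofLike , θ-realizes
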